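{- For every integer $n\ge 1$, letting $\Sigma$ be an alphabet with (at least) $2n$ letters, $\Gamma$ a finite alphabet with at least two letters and $\mathcal{I}$ the set of injective morphisms $\Sigma^*\to\Gamma^*$, there exists a word $w_n\in\Sigma^*$ over $2n$ letters with $|w_n|=6n$ and $\mathrm{E}(w_n)=1$ such that $$n-\frac16<\mathrm{E}_{\mathcal{I}}(w_n)<\infty.$$
   Context: For a nonempty word $v$ and natural number $p$, $v^{p/|v|}$ is the prefix of length $p$ of $vvv\cdots$. The fractional exponent of a nonempty word $u$ is $\mathrm{E}(u)=\sup\{r\in\mathbb{Q}\mid\exists v\ne\varepsilon: u=v^r\}$, and $\mathrm{E}_{\mathcal{I}}(u)=\sup\{\mathrm{E}(h(u))\mid h\in\mathcal{I}\}$. -}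

module Defs where

open import Data.Nat using (ℕ; suc)
open import Data.Integer using (+_)
open import Data.Rational using (ℚ; _/_; _-_; _≤_; _<_)
open import Data.List using (List; []; _∷_; length; take; concat; replicate; concatMap)
open import Data.Product using (Σ; ∃; _×_)
open import Relation.Binary.PropositionalEquality using (_≡_)
open import Function.Definitions using (Injective)

-- v^{p/|v|} : the prefix of length p of v v v ...  (for nonempty v,
-- p copies of v have length ≥ p, so this is that prefix)
powPrefix : {A : Set} → List A → ℕ → List A
powPrefix v p = take p (concat (replicate p v))

-- IsPow u r : there is a nonempty word v with u = v^r,
-- i.e. u = v^{p/|v|} and r = p/|v| for some natural p.
IsPow : {A : Set} → List A → ℚ → Set
IsPow {A} u r =
  Σ A λ x → Σ (List A) λ xs → Σ ℕ λ p →
    (u ≡ powPrefix (x ∷ xs) p) × (r ≡ (+ p) / suc (length xs))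

E≤ : {A : Set} → List A → ℚ → Set
E≤ u q = ∀ r → IsPow u r → r ≤ q

E> : {A : Set} → List A → ℚ → Set
E> u q = ∃ λ r → IsPow u r × q < r

E≡ : {A : Set} → List A → ℚ → Set
E≡ u q = E≤ u q × (∀ q' → q' < q → E> u q')

ext : {S G : Set} → (S → List G) → List S → List G
ext h w = concatMap h w

InjMorph : {S G : Set} → (S → List G) → Set
InjMorph h = Injective _≡_ _≡_ (ext h)

EI> : {S G : Set} → List S → ℚ → Set
EI> {S} {G} w q = Σ (S → List G) λ h → InjMorph h × E> (ext h w) q

EIfinite : {S G : Set} → List S → Set
EIfinite {S} {G} w = ∃ λ (B : ℚ) → (h : S → List G) → InjMorph h → E≤ (ext h w) B

module Submission where

-- The word w = ∏_{q<n} x_q x_q y_q x_q y_q y_q is unbordered, because x_0 occurs in it only at the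
-- positions 0, 1 and 3; hence E(w) = 1. Every letter c of w occurs as c α c β c with cα and cβ not
-- commuting. If an injective image h(w) had a root no longer than h(c), then h(c) would occur three
-- times in a word whose period is at most |h(c)|, and the Fine–Wilf argument would force
-- h(cα) h(cβ) = h(cβ) h(cα); so every root of h(w) is longer than every h(c), and E(h(w)) ≤ |w|.
-- On the other hand, the uniform code with h(x_q) = 0^(n−q) 1^(k+1) 0^q and h(y_q) = 0^(n−1−q) 1^k 0^(q+2)
-- satisfies 0^q h(x_q x_q y_q x_q y_q y_q) = v 0^(q+1) for a fixed word v beginning with 0^n, so
-- h(w) = v^n 0^n has exponent n + n/|v| > n − 1/6.

open import Data.Empty using (⊥)
open import Data.Fin using (Fin; toℕ)
import Data.Fin as Fin
open import Data.Fin.Properties using (toℕ-fromℕ<; toℕ<n; toℕ-injective)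
open import Data.Integer using (+_; +≤+)
import Data.Integer as ℤ
import Data.Integer.Properties as ℤ
open import Data.List using (List; []; _∷_; _++_; length; take; drop; concat; replicate; applyUpTo)
open import Data.List.Properties
  using (∷-injectiveˡ; ∷-injectiveʳ; ++-assoc; ++-identityʳ; length-++; length-replicate;
         length-applyUpTo; concatMap-++)
open import Data.List.Membership.Propositional using (_∈_; _∉_)
open import Data.List.Membership.Propositional.Properties
  using (∈-++⁻; ∈-++⁺ʳ; ∈-applyUpTo⁺; ∈-applyUpTo⁻)
open import Data.List.Relation.Unary.Any using (here; there)
open import Data.List.Relation.Unary.Unique.Propositional using (Unique)
open import Data.List.Relation.Unary.Unique.Propositional.Properties using (applyUpTo⁺₁)
open import Data.Nat using (ℕ; zero; suc; _+_; _*_; _∸_; _≤_; _<_; z≤n; s≤s; z<s; s<s; NonZero; _≟_; _<?_)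
open import Data.Nat.Properties
open import Data.Nat.DivMod
  using (_%_; _mod_; m≡m%n+[m/n]*n; m%n<n; m%n%n≡m%n; [m+n]%n≡m%n; m<n⇒m%n≡m; %-distribˡ-+)
import Data.Nat.DivMod as ℕ
open import Data.Nat.Divisibility using (_∣_; divides; m%n≡0⇒n∣m)
open import Data.Nat.Induction using (<-wellFounded)
open import Data.Nat.Tactic.RingSolver using (solve-∀)
open import Data.Product using (Σ; _×_; _,_; proj₁; proj₂; ∃; ∃₂)
open import Data.Rational using (_/_; _-_; -_) renaming (_≤_ to _≤ℚ_; _<_ to _<ℚ_)
import Data.Rational.Properties as ℚ
open import Data.Rational.Unnormalised using (mkℚᵘ; *≤*)
import Data.Rational.Unnormalised.Properties as ℚᵘ
open import Data.Sum using (_⊎_; inj₁; inj₂)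
open import Function using (_∘_; _⇔_; mk⇔)
open import Induction.WellFounded using (Acc; acc)
open import Relation.Binary.PropositionalEquality
open import Relation.Nullary using (yes; no; contradiction)

open import Defs

private variable
  A S G : Set

applyUpTo-+ : ∀ (f : ℕ → A) l m →
              applyUpTo f (l + m) ≡ applyUpTo f l ++ applyUpTo (λ t → f (l + t)) m
applyUpTo-+ f zero    m = refl
applyUpTo-+ f (suc l) m = cong (f 0 ∷_) (applyUpTo-+ (f ∘ suc) l m)

applyUpTo-cong : ∀ {f g : ℕ → A} l → (∀ {t} → t < l → f t ≡ g t) → applyUpTo f l ≡ applyUpTo g l
applyUpTo-cong zero    f≡g = refl
applyUpTo-cong (suc l) f≡g = cong₂ _∷_ (f≡g z<s) (applyUpTo-cong l (f≡g ∘ s<s))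

applyUpTo-injective : ∀ {f g : ℕ → A} l → applyUpTo f l ≡ applyUpTo g l → ∀ {t} → t < l → f t ≡ g t
applyUpTo-injective (suc l) eq {zero}  _         = ∷-injectiveˡ eq
applyUpTo-injective (suc l) eq {suc t} (s<s t<l) = applyUpTo-injective l (∷-injectiveʳ eq) t<l

take-applyUpTo : ∀ (f : ℕ → A) {p l} → p ≤ l → take p (applyUpTo f l) ≡ applyUpTo f p
take-applyUpTo f z≤n       = refl
take-applyUpTo f (s≤s p≤l) = cong (f 0 ∷_) (take-applyUpTo (f ∘ suc) p≤l)

++-applyUpTo : ∀ (xs ys : List A) {f l} → xs ++ ys ≡ applyUpTo f l →
               xs ≡ applyUpTo f (length xs) × ys ≡ applyUpTo (λ t → f (length xs + t)) (length ys)
++-applyUpTo []       ys {f} {l} eq =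
  refl , trans eq (cong (applyUpTo f) (trans (sym (length-applyUpTo f l)) (cong length (sym eq))))
++-applyUpTo (x ∷ xs) ys {l = suc l} eq =
  let xs≡ , ys≡ = ++-applyUpTo xs ys (∷-injectiveʳ eq) in cong₂ _∷_ (∷-injectiveˡ eq) xs≡ , ys≡

++-cancel-length : ∀ (xs xs′ : List A) {ys ys′} → length xs ≡ length xs′ → xs ++ ys ≡ xs′ ++ ys′ →
                   xs ≡ xs′ × ys ≡ ys′
++-cancel-length []       []         _   eq = refl , eq
++-cancel-length (x ∷ xs) (x′ ∷ xs′) len eq =
  let xs≡ , ys≡ = ++-cancel-length xs xs′ (suc-injective len) (∷-injectiveʳ eq)
  in cong₂ _∷_ (∷-injectiveˡ eq) xs≡ , ys≡

replicate-+ : ∀ a b (c : A) → replicate (a + b) c ≡ replicate a c ++ replicate b c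
replicate-+ zero    b c = refl
replicate-+ (suc a) b c = cong (c ∷_) (replicate-+ a b c)

shift-++ : ∀ (z s t z′ : List A) {s′ t′ z″} → z ++ s ≡ t ++ z′ → z′ ++ s′ ≡ t′ ++ z″ →
           z ++ s ++ s′ ≡ (t ++ t′) ++ z″
shift-++ z s t z′ {s′} {t′} {z″} zs≡tz′ z′s′≡t′z″ = begin
  z ++ s ++ s′      ≡⟨ ++-assoc z s s′ ⟨
  (z ++ s) ++ s′    ≡⟨ cong (_++ s′) zs≡tz′ ⟩
  (t ++ z′) ++ s′   ≡⟨ ++-assoc t z′ s′ ⟩
  t ++ z′ ++ s′     ≡⟨ cong (t ++_) z′s′≡t′z″ ⟩
  t ++ t′ ++ z″     ≡⟨ ++-assoc t t′ z″ ⟨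
  (t ++ t′) ++ z″   ∎
  where open ≡-Reasoning

-- Periodic sequences

Periodic : (ℕ → A) → ℕ → Set
Periodic f d = ∀ x → f (d + x) ≡ f x

module _ {f : ℕ → A} where

  periodic-* : ∀ {d} → Periodic f d → ∀ q → Periodic f (q * d)
  periodic-*     p zero    x = refl
  periodic-* {d} p (suc q) x = trans (cong f (+-assoc d (q * d) x)) (trans (p _) (periodic-* p q x))

  periodic-∣ : ∀ {d D} → Periodic f d → d ∣ D → Periodic f D
  periodic-∣ p (divides q refl) = periodic-* p q

  periodic-% : ∀ {d} .{{_ : NonZero d}} → Periodic f d → ∀ x → f x ≡ f (x % d)
  periodic-% {d} p x =
    trans (cong f (trans (m≡m%n+[m/n]*n x d) (+-comm (x % d) _))) (periodic-* p (x ℕ./ d) (x % d))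

  periodic-shift : ∀ {d} → Periodic f d → ∀ i → Periodic (λ t → f (i + t)) d
  periodic-shift {d} p i x =
    trans (cong f (trans (sym (+-assoc i d x)) (trans (cong (_+ x) (+-comm i d)) (+-assoc d i x)))) (p (i + x))

  applyUpTo-periodic : ∀ {d} → Periodic f d → ∀ l → applyUpTo (λ t → f (d + t)) l ≡ applyUpTo f l
  applyUpTo-periodic p l = applyUpTo-cong l (λ {t} _ → p t)

  periodic-%-shift : ∀ {Q ℓ D} .{{_ : NonZero Q}} → Periodic f Q → Q ≤ ℓ →
                     (∀ {t} → t < ℓ → f t ≡ f (D + t)) → Periodic f (D % Q)
  periodic-%-shift {Q} {ℓ} {D} p Q≤ℓ agree x = begin
    f (D % Q + x)        ≡⟨ periodic-% p _ ⟩
    f ((D % Q + x) % Q)  ≡⟨ cong f same-residue ⟩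
    f ((D + x % Q) % Q)  ≡⟨ periodic-% p _ ⟨
    f (D + x % Q)        ≡⟨ agree (<-≤-trans (m%n<n x Q) Q≤ℓ) ⟨
    f (x % Q)            ≡⟨ periodic-% p x ⟨
    f x                  ∎
    where
    open ≡-Reasoning
    same-residue : (D % Q + x) % Q ≡ (D + x % Q) % Q
    same-residue = begin
      (D % Q + x) % Q            ≡⟨ %-distribˡ-+ (D % Q) x Q ⟩
      (D % Q % Q + x % Q) % Q    ≡⟨ cong (λ r → (r + x % Q) % Q) (m%n%n≡m%n D Q) ⟩
      (D % Q + x % Q) % Q        ≡⟨ cong (λ r → (D % Q + r) % Q) (m%n%n≡m%n x Q) ⟨
      (D % Q + x % Q % Q) % Q    ≡⟨ %-distribˡ-+ D (x % Q) Q ⟨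
      (D + x % Q) % Q            ∎

  -- Euclid's algorithm on the periods, as in the proof of the Fine–Wilf theorem
  periodic-shifts : ∀ {Q ℓ D₁ D₂} .{{_ : NonZero Q}} → Periodic f Q → Q ≤ ℓ →
                    (∀ {t} → t < ℓ → f t ≡ f (D₁ + t)) →
                    (∀ {t} → t < ℓ → f t ≡ f (D₂ + t)) →
                    Periodic f D₁ × Periodic f D₂
  periodic-shifts {Q} {ℓ} {D₁} {D₂} pQ Q≤ℓ agree₁ agree₂ = go (<-wellFounded Q) pQ Q≤ℓ
    where
    remainder< : ∀ {D Q r} .{{_ : NonZero Q}} → D % Q ≡ r → r < Q
    remainder< {D} {Q} refl = m%n<n D Q

    go : ∀ {Q} .{{_ : NonZero Q}} → Acc _<_ Q → Periodic f Q → Q ≤ ℓ → Periodic f D₁ × Periodic f D₂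
    go {Q} (acc smaller) pQ Q≤ℓ with D₁ % Q in e₁ | D₂ % Q in e₂
    ... | suc r | _     = go (smaller (remainder< e₁))
                             (subst (Periodic f) e₁ (periodic-%-shift pQ Q≤ℓ agree₁))
                             (≤-trans (<⇒≤ (remainder< e₁)) Q≤ℓ)
    ... | zero  | suc r = go (smaller (remainder< e₂))
                             (subst (Periodic f) e₂ (periodic-%-shift pQ Q≤ℓ agree₂))
                             (≤-trans (<⇒≤ (remainder< e₂)) Q≤ℓ)
    ... | zero  | zero  = periodic-∣ pQ (m%n≡0⇒n∣m D₁ Q e₁) , periodic-∣ pQ (m%n≡0⇒n∣m D₂ Q e₂)

  periodic-commute : ∀ {a b} → Periodic f a → Periodic f (a + b) →
                     applyUpTo f a ++ applyUpTo (λ t → f (a + t)) b ≡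
                     applyUpTo (λ t → f (a + t)) b ++ applyUpTo f a
  periodic-commute {a} {b} pa pab = begin
    applyUpTo f a ++ applyUpTo f[a+] b                           ≡⟨ applyUpTo-+ f a b ⟨
    applyUpTo f (a + b)                                          ≡⟨ applyUpTo-periodic pa (a + b) ⟨
    applyUpTo f[a+] (a + b)                                      ≡⟨ cong (applyUpTo f[a+]) (+-comm a b) ⟩
    applyUpTo f[a+] (b + a)                                      ≡⟨ applyUpTo-+ f[a+] b a ⟩
    applyUpTo f[a+] b ++ applyUpTo (λ t → f (a + (b + t))) a     ≡⟨ cong (applyUpTo f[a+] b ++_) shift-by-a+b ⟩
    applyUpTo f[a+] b ++ applyUpTo f a                           ∎
    where
    open ≡-Reasoning
    f[a+] = λ t → f (a + t)
    shift-by-a+b : applyUpTo (λ t → f (a + (b + t))) a ≡ applyUpTo f a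
    shift-by-a+b = applyUpTo-cong a (λ {t} _ → trans (cong f (sym (+-assoc a b t))) (pab t))

periodic-returns-commute : ∀ {f : ℕ → A} {P l} .{{_ : NonZero P}} → Periodic f P →
                           ∀ z X Y R → P ≤ length z →
                           (z ++ X) ++ (z ++ Y) ++ z ++ R ≡ applyUpTo f l →
                           (z ++ X) ++ (z ++ Y) ≡ (z ++ Y) ++ (z ++ X)
periodic-returns-commute {f = f} pP z X Y R P≤z eq = begin
  (z ++ X) ++ (z ++ Y)                             ≡⟨ cong₂ _++_ zX≡ zY≡ ⟩
  applyUpTo f a ++ applyUpTo (λ t → f (a + t)) b   ≡⟨ periodic-commute pa pab ⟩
  applyUpTo (λ t → f (a + t)) b ++ applyUpTo f a   ≡⟨ cong₂ _++_ zY≡ zX≡ ⟨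
  (z ++ Y) ++ (z ++ X)                             ∎
  where
  open ≡-Reasoning
  a = length (z ++ X)
  b = length (z ++ Y)
  split₁ = ++-applyUpTo (z ++ X) _ eq
  zX≡ = proj₁ split₁
  split₂ = ++-applyUpTo (z ++ Y) _ (proj₂ split₁)
  zY≡ = proj₁ split₂
  z≡₀ = proj₁ (++-applyUpTo z X zX≡)
  z≡₁ = proj₁ (++-applyUpTo z Y zY≡)
  z≡₂ = proj₁ (++-applyUpTo z R (proj₂ split₂))
  agree₁ : ∀ {t} → t < length z → f t ≡ f (a + t)
  agree₁ = applyUpTo-injective _ (trans (sym z≡₀) z≡₁)
  agree₂ : ∀ {t} → t < length z → f t ≡ f ((a + b) + t)
  agree₂ t<z = trans (applyUpTo-injective _ (trans (sym z≡₀) z≡₂) t<z) (cong f (sym (+-assoc a b _)))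
  periods = periodic-shifts pP P≤z agree₁ agree₂
  pa = proj₁ periods
  pab = proj₂ periods

-- Fractional powers

nth : A → List A → ℕ → A
nth d []       _       = d
nth d (x ∷ xs) zero    = x
nth d (x ∷ xs) (suc i) = nth d xs i

applyUpTo-nth : ∀ (d : A) xs → applyUpTo (nth d xs) (length xs) ≡ xs
applyUpTo-nth d []       = refl
applyUpTo-nth d (x ∷ xs) = cong (x ∷_) (applyUpTo-nth d xs)

cycle : A → List A → ℕ → A
cycle x xs t = nth x (x ∷ xs) (t % suc (length xs))

module _ (x : A) (xs : List A) where

  private
    P = suc (length xs)
    F = cycle x xs

  cycle-periodic : Periodic F P
  cycle-periodic t = cong (nth x (x ∷ xs)) (trans (cong (_% P) (+-comm P t)) ([m+n]%n≡m%n t P))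

  applyUpTo-cycle : applyUpTo F P ≡ x ∷ xs
  applyUpTo-cycle =
    trans (applyUpTo-cong P (λ t<P → cong (nth x (x ∷ xs)) (m<n⇒m%n≡m t<P))) (applyUpTo-nth x (x ∷ xs))

  concat-replicate-cycle : ∀ c → concat (replicate c (x ∷ xs)) ≡ applyUpTo F (c * P)
  concat-replicate-cycle zero    = refl
  concat-replicate-cycle (suc c) = sym (begin
    applyUpTo F (P + c * P)                       ≡⟨ applyUpTo-+ F P (c * P) ⟩
    applyUpTo F P ++ applyUpTo (λ t → F (P + t)) (c * P)
      ≡⟨ cong₂ _++_ applyUpTo-cycle (applyUpTo-periodic {f = F} {d = P} cycle-periodic (c * P)) ⟩
    (x ∷ xs) ++ applyUpTo F (c * P)               ≡⟨ cong ((x ∷ xs) ++_) (concat-replicate-cycle c) ⟨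
    (x ∷ xs) ++ concat (replicate c (x ∷ xs))     ∎)
    where open ≡-Reasoning

  powPrefix-cycle : ∀ p → powPrefix (x ∷ xs) p ≡ applyUpTo F p
  powPrefix-cycle p = trans (cong (take p) (concat-replicate-cycle p)) (take-applyUpTo F (m≤m*n p P))

  length-powPrefix : ∀ p → length (powPrefix (x ∷ xs) p) ≡ p
  length-powPrefix p = trans (cong length (powPrefix-cycle p)) (length-applyUpTo F p)

  powPrefix-*-+ : ∀ c z r → x ∷ xs ≡ z ++ r →
                  powPrefix (x ∷ xs) (c * P + length z) ≡ concat (replicate c (x ∷ xs)) ++ z
  powPrefix-*-+ c z r v≡zr = begin
    powPrefix (x ∷ xs) (c * P + length z)                                ≡⟨ powPrefix-cycle _ ⟩
    applyUpTo F (c * P + length z)                                       ≡⟨ applyUpTo-+ F (c * P) (length z) ⟩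
    applyUpTo F (c * P) ++ applyUpTo (λ t → F (c * P + t)) (length z)
      ≡⟨ cong₂ _++_ (sym (concat-replicate-cycle c))
                    (applyUpTo-periodic {f = F} {d = c * P} (periodic-* {d = P} cycle-periodic c) _) ⟩
    concat (replicate c (x ∷ xs)) ++ applyUpTo F (length z)              ≡⟨ cong (_ ++_) z≡ ⟨
    concat (replicate c (x ∷ xs)) ++ z                                   ∎
    where
    open ≡-Reasoning
    z≡ = proj₁ (++-applyUpTo z r (trans (sym v≡zr) (sym applyUpTo-cycle)))

*≤*⇒/≤/ : ∀ a b c d → a * suc d ≤ c * suc b → (+ a) / suc b ≤ℚ (+ c) / suc d
*≤*⇒/≤/ a b c d le = ℚ.toℚᵘ-cancel-≤
  (ℚᵘ.≤-respˡ-≃ (ℚᵘ.≃-sym (ℚ.toℚᵘ-fromℚᵘ (mkℚᵘ (+ a) b)))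
  (ℚᵘ.≤-respʳ-≃ (ℚᵘ.≃-sym (ℚ.toℚᵘ-fromℚᵘ (mkℚᵘ (+ c) d)))
  (*≤* (subst₂ ℤ._≤_ (ℤ.pos-* a (suc d)) (ℤ.pos-* c (suc b)) (+≤+ le)))))

q-1/6<q : ∀ q → q - (+ 1) / 6 <ℚ q
q-1/6<q q =
  ℚ.<-respʳ-≡ (ℚ.+-identityʳ q) (ℚ.+-mono-≤-< (ℚ.≤-refl {q}) (ℚ.negative⁻¹ (- ((+ 1) / 6))))

E≡1 : ∀ {x : A} {xs} →
      (∀ {f P} → Periodic f (suc P) → x ∷ xs ≡ applyUpTo f (suc (length xs)) →
                 suc (length xs) ≤ suc P) →
      E≡ (x ∷ xs) ((+ 1) / 1)
E≡1 {x = x} {xs} unbordered = upper , lower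
  where
  P = suc (length xs)
  upper : E≤ (x ∷ xs) ((+ 1) / 1)
  upper r (y , ys , p , w≡ , refl) = *≤*⇒/≤/ p (length ys) 1 0 (begin
    p * 1      ≡⟨ *-identityʳ p ⟩
    p          ≡⟨ p≡ ⟩
    P          ≤⟨ unbordered (cycle-periodic y ys) w≡cycle ⟩
    suc (length ys)      ≡⟨ *-identityˡ _ ⟨
    1 * suc (length ys)  ∎)
    where
    open ≤-Reasoning
    p≡ : p ≡ P
    p≡ = trans (sym (length-powPrefix y ys p)) (cong length (sym w≡))
    w≡cycle = trans w≡ (trans (powPrefix-cycle y ys p) (cong (applyUpTo (cycle y ys)) p≡))
  lower : ∀ q → q <ℚ (+ 1) / 1 → E> (x ∷ xs) q
  lower q q<1 =
    (+ P) / P , (x , xs , P , sym (trans (powPrefix-cycle x xs P) (applyUpTo-cycle x xs)) , refl) ,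
    ℚ.<-≤-trans q<1 (*≤*⇒/≤/ 1 0 P (length xs) (≤-reflexive (trans (*-identityˡ P) (sym (*-identityʳ P)))))

-- Exponents of images under injective morphisms

record NoncommutingReturns (w : List S) (c : S) : Set where
  field
    pre α β post : List S
    split        : w ≡ pre ++ (c ∷ α) ++ (c ∷ β) ++ c ∷ post
    noncommuting : (c ∷ α) ++ (c ∷ β) ≢ (c ∷ β) ++ (c ∷ α)

module _ (h : S → List G) where

  length-concatMap-≤ : ∀ {B} w → (∀ {c} → c ∈ w → length (h c) ≤ B) →
                       length (ext h w) ≤ length w * B
  length-concatMap-≤ []      _     = z≤n
  length-concatMap-≤ {B} (c ∷ w) bound = begin
    length (h c ++ ext h w)          ≡⟨ length-++ (h c) ⟩
    length (h c) + length (ext h w)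
      ≤⟨ +-mono-≤ (bound (here refl)) (length-concatMap-≤ w (bound ∘ there)) ⟩
    B + length w * B                 ∎
    where open ≤-Reasoning

  uniform-injective : ∀ {L} → (∀ c → length (h c) ≡ suc L) →
                      (∀ {c c′} → h c ≡ h c′ → c ≡ c′) → InjMorph h
  uniform-injective len inj {w} {w′} = injective w w′
    where
    nonempty : ∀ c w → ext h (c ∷ w) ≢ []
    nonempty c w eq = 0≢1+n (trans (cong length (sym eq)) (trans (length-++ (h c)) (cong (_+ _) (len c))))

    injective : ∀ w w′ → ext h w ≡ ext h w′ → w ≡ w′
    injective []      []        _  = refl
    injective []      (c ∷ w)   eq = contradiction (sym eq) (nonempty c w)
    injective (c ∷ w) []        eq = contradiction eq (nonempty c w)
    injective (c ∷ w) (c′ ∷ w′) eq =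
      let hc≡hc′ , rest≡ = ++-cancel-length (h c) (h c′) (trans (len c) (sym (len c′))) eq
      in cong₂ _∷_ (inj hc≡hc′) (injective w w′ rest≡)

  root-longer-than-image : InjMorph h → ∀ {w c} → NoncommutingReturns w c →
                           ∀ {x xs p} → ext h w ≡ powPrefix (x ∷ xs) p → length (h c) < suc (length xs)
  root-longer-than-image inj {w} {c} returns {x} {xs} {p} eq =
    ≰⇒> (λ P≤|hc| → noncommuting (inj (commute P≤|hc|)))
    where
    open NoncommutingReturns returns
    image-split : ext h w ≡ ext h pre ++ (h c ++ ext h α) ++ (h c ++ ext h β) ++ h c ++ ext h post
    image-split = trans (cong (ext h) split) (trans (concatMap-++ h pre _) (cong (ext h pre ++_)
                    (trans (concatMap-++ h (c ∷ α) _) (cong (ext h (c ∷ α) ++_) (concatMap-++ h (c ∷ β) _)))))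
    suffix = proj₂ (++-applyUpTo (ext h pre) _ (trans (sym image-split) (trans eq (powPrefix-cycle x xs p))))
    commute : suc (length xs) ≤ length (h c) → ext h ((c ∷ α) ++ (c ∷ β)) ≡ ext h ((c ∷ β) ++ (c ∷ α))
    commute P≤|hc| = begin
      ext h ((c ∷ α) ++ (c ∷ β))              ≡⟨ concatMap-++ h (c ∷ α) (c ∷ β) ⟩
      ext h (c ∷ α) ++ ext h (c ∷ β)          ≡⟨ periodic-returns-commute {P = suc (length xs)} periodic
                                                   (h c) (ext h α) (ext h β) (ext h post) P≤|hc| suffix ⟩
      ext h (c ∷ β) ++ ext h (c ∷ α)          ≡⟨ concatMap-++ h (c ∷ β) (c ∷ α) ⟨
      ext h ((c ∷ β) ++ (c ∷ α))              ∎
      where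
      open ≡-Reasoning
      periodic = periodic-shift {f = cycle x xs} (cycle-periodic x xs) (length (ext h pre))

  E≤-length : InjMorph h → ∀ {w} → (∀ {c} → c ∈ w → NoncommutingReturns w c) →
              E≤ (ext h w) ((+ length w) / 1)
  E≤-length inj {w} returns r (x , xs , p , eq , refl) = *≤*⇒/≤/ p (length xs) (length w) 0 (begin
    p * 1                        ≡⟨ *-identityʳ p ⟩
    p                            ≡⟨ trans (sym (length-powPrefix x xs p)) (cong length (sym eq)) ⟩
    length (ext h w)
      ≤⟨ length-concatMap-≤ w (λ c∈w → <⇒≤ (root-longer-than-image inj (returns c∈w) eq)) ⟩
    length w * suc (length xs)   ∎)
    where open ≤-Reasoning

-- The word w_n

module Word (n′ k′ : ℕ) (2n≤k : 2 * suc n′ ≤ suc k′) where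

  n : ℕ
  n = suc n′

  k : ℕ
  k = suc k′

  ∸n<n : ∀ {j} → n ≤ j → j < 2 * n → j ∸ n < n
  ∸n<n {j} n≤j j<2n = subst (j ∸ n <_) (trans (m+n∸m≡n n (n + 0)) (+-identityʳ n)) (∸-monoˡ-< j<2n n≤j)

  letter : ℕ → Fin k
  letter j = j mod k

  toℕ-letter : ∀ {j} → j < k → toℕ (letter j) ≡ j
  toℕ-letter {j} j<k = trans (toℕ-fromℕ< _) (m<n⇒m%n≡m j<k)

  letter-injective : ∀ {i j} → i < k → j < k → letter i ≡ letter j → i ≡ j
  letter-injective i<k j<k eq = trans (sym (toℕ-letter i<k)) (trans (cong toℕ eq) (toℕ-letter j<k))

  x y : ℕ → Fin k
  x q = letter q
  y q = letter (n + q)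

  x-bound : ∀ {q} → q < n → q < 2 * n
  x-bound q<n = <-≤-trans q<n (m≤m+n n (n + 0))

  y-bound : ∀ {q} → q < n → n + q < 2 * n
  y-bound {q} q<n = +-monoʳ-< n (subst (q <_) (sym (+-identityʳ n)) q<n)

  x<k : ∀ {q} → q < n → q < k
  x<k q<n = <-≤-trans (x-bound q<n) 2n≤k

  y<k : ∀ {q} → q < n → n + q < k
  y<k q<n = <-≤-trans (y-bound q<n) 2n≤k

  x≢y : ∀ {q q′} → q < n → q′ < n → x q ≢ y q′
  x≢y {q} {q′} q<n q′<n eq =
    <⇒≱ q<n (subst (n ≤_) (sym (letter-injective (x<k q<n) (y<k q′<n) eq)) (m≤m+n n q′))

  block : ℕ → List (Fin k)
  block q = x q ∷ x q ∷ y q ∷ x q ∷ y q ∷ y q ∷ []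

  blocksFrom : ℕ → ℕ → List (Fin k)
  blocksFrom a zero    = []
  blocksFrom a (suc c) = block a ++ blocksFrom (suc a) c

  w : List (Fin k)
  w = blocksFrom 0 n

  length-blocksFrom : ∀ a c → length (blocksFrom a c) ≡ 6 * c
  length-blocksFrom a zero    = sym (*-zeroʳ 6)
  length-blocksFrom a (suc c) = trans (cong (λ m → 6 + m) (length-blocksFrom (suc a) c)) (sym (*-suc 6 c))

  ∈-block⁻ : ∀ {q l} → l ∈ block q → l ≡ x q ⊎ l ≡ y q
  ∈-block⁻ (here eq)                                  = inj₁ eq
  ∈-block⁻ (there (here eq))                          = inj₁ eq
  ∈-block⁻ (there (there (here eq)))                  = inj₂ eq
  ∈-block⁻ (there (there (there (here eq))))          = inj₁ eq
  ∈-block⁻ (there (there (there (there (here eq)))))  = inj₂ eq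
  ∈-block⁻ (there (there (there (there (there (here eq)))))) = inj₂ eq

  ∈-blocksFrom⁻ : ∀ a c {l} → l ∈ blocksFrom a c →
                  ∃ λ q → a ≤ q × q < a + c × (l ≡ x q ⊎ l ≡ y q)
  ∈-blocksFrom⁻ a (suc c) l∈ with ∈-++⁻ (block a) l∈
  ... | inj₁ l∈block = a , ≤-refl , m<m+n a z<s , ∈-block⁻ l∈block
  ... | inj₂ l∈rest  =
    let q , a<q , q<1+a+c , l≡ = ∈-blocksFrom⁻ (suc a) c l∈rest
    in q , <⇒≤ a<q , subst (q <_) (sym (+-suc a c)) q<1+a+c , l≡

  blocksFrom-split : ∀ {a q} c → a ≤ q → q < a + c →
                     ∃₂ λ pre post → blocksFrom a c ≡ pre ++ block q ++ post
  blocksFrom-split {a} {q} zero    a≤q q<a+0 = contradiction a≤q (<⇒≱ (subst (q <_) (+-identityʳ a) q<a+0))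
  blocksFrom-split {a} {q} (suc c) a≤q q<a+c with m≤n⇒m<n∨m≡n a≤q
  ... | inj₂ refl = [] , blocksFrom (suc a) c , refl
  ... | inj₁ a<q  =
    let pre , post , eq = blocksFrom-split c a<q (subst (q <_) (+-suc a c) q<a+c)
    in block a ++ pre , post , trans (cong (block a ++_) eq) (sym (++-assoc (block a) pre _))

  w-split : ∀ {q} → q < n → ∃₂ λ pre post → w ≡ pre ++ block q ++ post
  w-split = blocksFrom-split n z≤n

  x∈w : ∀ {q} → q < n → x q ∈ w
  x∈w q<n = let pre , _ , eq = w-split q<n in subst (_ ∈_) (sym eq) (∈-++⁺ʳ pre (here refl))

  y∈w : ∀ {q} → q < n → y q ∈ w
  y∈w q<n = let pre , _ , eq = w-split q<n in subst (_ ∈_) (sym eq) (∈-++⁺ʳ pre (there (there (here refl))))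

  returns : ∀ {l} → l ∈ w → NoncommutingReturns w l
  returns l∈w with ∈-blocksFrom⁻ 0 n l∈w
  ... | q , _ , q<n , inj₁ refl = let pre , post , eq = w-split q<n in record
    { pre = pre ; α = [] ; β = y q ∷ [] ; post = y q ∷ y q ∷ post ; split = eq
    ; noncommuting = x≢y q<n q<n ∘ ∷-injectiveˡ ∘ ∷-injectiveʳ }
  ... | q , _ , q<n , inj₂ refl = let pre , post , eq = w-split q<n in record
    { pre = pre ++ x q ∷ x q ∷ [] ; α = x q ∷ [] ; β = [] ; post = post
    ; split = trans eq (sym (++-assoc pre (x q ∷ x q ∷ []) _))
    ; noncommuting = x≢y q<n q<n ∘ ∷-injectiveˡ ∘ ∷-injectiveʳ }

  x₀∉blocksFrom₁ : x 0 ∉ blocksFrom 1 n′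
  x₀∉blocksFrom₁ x₀∈ with ∈-blocksFrom⁻ 1 n′ x₀∈
  ... | q , 1≤q , q<n , inj₁ eq = <⇒≢ 1≤q (letter-injective (x<k z<s) (x<k q<n) eq)
  ... | q , _   , q<n , inj₂ eq = x≢y z<s q<n eq

  w-unbordered : ∀ {f P} → Periodic f (suc P) → w ≡ applyUpTo f (length w) → length w ≤ suc P
  w-unbordered {f} p w≡ = ≮⇒≥ (no-short-period p)
    where
    split = ++-applyUpTo (block 0) (blocksFrom 1 n′) {f = f} w≡

    clash : ∀ i j → nth (x 0) (applyUpTo f 6) i ≡ nth (x 0) (applyUpTo f 6) j →
            nth (x 0) (block 0) i ≡ nth (x 0) (block 0) j
    clash i j eq = trans (cong (λ u → nth (x 0) u i) (proj₁ split))
                         (trans eq (cong (λ u → nth (x 0) u j) (sym (proj₁ split))))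

    no-short-period : ∀ {P} → Periodic f (suc P) → suc P < length w → ⊥
    no-short-period {0} p _ = x≢y z<s z<s (clash 1 2 (sym (p 1)))
    no-short-period {1} p _ = x≢y z<s z<s (clash 0 2 (sym (p 0)))
    no-short-period {2} p _ = x≢y z<s z<s (clash 1 4 (sym (p 1)))
    no-short-period {3} p _ = x≢y z<s z<s (clash 0 4 (sym (p 0)))
    no-short-period {4} p _ = x≢y z<s z<s (clash 0 5 (sym (p 0)))
    no-short-period {suc (suc (suc (suc (suc t))))} p (s<s (s<s (s<s (s<s (s<s (s<s t<rest)))))) =
      x₀∉blocksFrom₁ (subst (_∈ blocksFrom 1 n′) (sym x₀≡f[6+t])
        (subst (f (6 + t) ∈_) (sym (proj₂ split)) (∈-applyUpTo⁺ (λ s → f (6 + s)) t<rest)))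
      where
      x₀≡f[6+t] : x 0 ≡ f (6 + t)
      x₀≡f[6+t] =
        trans (cong (λ u → nth (x 0) u 0) (proj₁ split)) (trans (sym (p 0)) (cong f (+-identityʳ (6 + t))))

  E≡w : E≡ w ((+ 1) / 1)
  E≡w = E≡1 w-unbordered

  alphabet : List (Fin k)
  alphabet = applyUpTo letter (2 * n)

  alphabet-unique : Unique alphabet
  alphabet-unique = applyUpTo⁺₁ letter (2 * n) λ i<j j<2n →
    let j<k = <-≤-trans j<2n 2n≤k in <⇒≢ i<j ∘ letter-injective (<-trans i<j j<k) j<k

  ∈-alphabet⁺ : ∀ {l} → l ∈ w → l ∈ alphabet
  ∈-alphabet⁺ l∈w with ∈-blocksFrom⁻ 0 n l∈w
  ... | q , _ , q<n , inj₁ refl = ∈-applyUpTo⁺ letter (x-bound q<n)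
  ... | q , _ , q<n , inj₂ refl = ∈-applyUpTo⁺ letter (y-bound q<n)

  ∈-alphabet⁻ : ∀ {l} → l ∈ alphabet → l ∈ w
  ∈-alphabet⁻ l∈ with ∈-applyUpTo⁻ letter l∈
  ... | j , j<2n , refl with j <? n
  ...   | yes j<n = x∈w j<n
  ...   | no  j≮n = subst (_∈ w) (cong letter (m+[n∸m]≡n n≤j)) (y∈w (∸n<n n≤j j<2n))
    where n≤j = ≮⇒≥ j≮n

-- An injective morphism under which w_n has a large exponent

module Morphism (n′ k′ m′ : ℕ) (2n≤k : 2 * suc n′ ≤ suc k′) where

  open Word n′ k′ 2n≤k

  Γ : Set
  Γ = Fin (suc (suc m′))

  g₀ g₁ : Γ
  g₀ = Fin.zero
  g₁ = Fin.suc Fin.zero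

  g₀≢g₁ : g₀ ≢ g₁
  g₀≢g₁ ()

  Z O : ℕ → List Γ
  Z j = replicate j g₀
  O j = replicate j g₁

  code : ℕ × ℕ × ℕ → List Γ
  code (a , m , c) = Z a ++ O (suc m) ++ Z c

  length-code : ∀ a m c → length (code (a , m , c)) ≡ a + c + suc m
  length-code a m c = begin
    length (Z a ++ O (suc m) ++ Z c)              ≡⟨ length-++ (Z a) ⟩
    length (Z a) + length (O (suc m) ++ Z c)      ≡⟨ cong (_+_ (length (Z a))) (length-++ (O (suc m))) ⟩
    length (Z a) + (length (O (suc m)) + length (Z c))
      ≡⟨ cong₂ _+_ (length-replicate a) (cong₂ _+_ (length-replicate (suc m)) (length-replicate c)) ⟩
    a + (suc m + c)                               ≡⟨ cong (_+_ a) (+-comm (suc m) c) ⟩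
    a + (c + suc m)                               ≡⟨ +-assoc a c (suc m) ⟨
    a + c + suc m                                 ∎
    where open ≡-Reasoning

  Z-++-g₁-injective : ∀ a a′ {R R′} → Z a ++ g₁ ∷ R ≡ Z a′ ++ g₁ ∷ R′ → a ≡ a′ × R ≡ R′
  Z-++-g₁-injective zero    zero     eq = refl , ∷-injectiveʳ eq
  Z-++-g₁-injective zero    (suc a′) eq = contradiction (sym (∷-injectiveˡ eq)) g₀≢g₁
  Z-++-g₁-injective (suc a) zero     eq = contradiction (∷-injectiveˡ eq) g₀≢g₁
  Z-++-g₁-injective (suc a) (suc a′) eq =
    let a≡a′ , R≡R′ = Z-++-g₁-injective a a′ (∷-injectiveʳ eq) in cong suc a≡a′ , R≡R′

  O-++-Z-injective : ∀ m m′ {c c′} → O m ++ Z c ≡ O m′ ++ Z c′ → m ≡ m′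
  O-++-Z-injective zero    zero              eq = refl
  O-++-Z-injective zero    (suc m′) {zero}   ()
  O-++-Z-injective zero    (suc m′) {suc c}  eq = contradiction (∷-injectiveˡ eq) g₀≢g₁
  O-++-Z-injective (suc m) zero     {c′ = zero}  ()
  O-++-Z-injective (suc m) zero     {c′ = suc c} eq = contradiction (sym (∷-injectiveˡ eq)) g₀≢g₁
  O-++-Z-injective (suc m) (suc m′) eq = cong suc (O-++-Z-injective m m′ (∷-injectiveʳ eq))

  code-injective : ∀ s s′ → code s ≡ code s′ →
                   proj₁ s ≡ proj₁ s′ × proj₁ (proj₂ s) ≡ proj₁ (proj₂ s′)
  code-injective (a , m , c) (a′ , m′ , c′) eq =
    let a≡a′ , rest≡ = Z-++-g₁-injective a a′ eq in a≡a′ , O-++-Z-injective m m′ rest≡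

  Z-++-code : ∀ q a m c d → Z q ++ code (a , m , c + d) ≡ code (q + a , m , c) ++ Z d
  Z-++-code q a m c d = begin
    Z q ++ Z a ++ O (suc m) ++ Z (c + d)        ≡⟨ ++-assoc (Z q) (Z a) _ ⟨
    (Z q ++ Z a) ++ O (suc m) ++ Z (c + d)
      ≡⟨ cong₂ (λ s t → s ++ O (suc m) ++ t) (sym (replicate-+ q a g₀)) (replicate-+ c d g₀) ⟩
    Z (q + a) ++ O (suc m) ++ Z c ++ Z d        ≡⟨ cong (Z (q + a) ++_) (++-assoc (O (suc m)) (Z c) (Z d)) ⟨
    Z (q + a) ++ (O (suc m) ++ Z c) ++ Z d      ≡⟨ ++-assoc (Z (q + a)) _ (Z d) ⟨
    (Z (q + a) ++ O (suc m) ++ Z c) ++ Z d      ∎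
    where open ≡-Reasoning

  -- Every other letter j gets j − 2n + 1 < k ones, so decode reads j off the first two runs of the image.
  shape : ℕ → ℕ × ℕ × ℕ
  shape j with j <? n | j <? 2 * n
  ... | yes _ | _     = n ∸ j , k , j
  ... | no _  | yes _ = n′ ∸ (j ∸ n) , k′ , 2 + (j ∸ n)
  ... | no _  | no _  = 0 , j ∸ 2 * n , n + k ∸ (j ∸ 2 * n)

  shape-x : ∀ {q} → q < n → shape q ≡ (n ∸ q , k , q)
  shape-x {q} q<n with q <? n | q <? 2 * n
  ... | yes _  | _ = refl
  ... | no q≮n | _ = contradiction q<n q≮n

  shape-y : ∀ {q} → q < n → shape (n + q) ≡ (n′ ∸ q , k′ , 2 + q)
  shape-y {q} q<n with n + q <? n | n + q <? 2 * n
  ... | yes n+q<n | _         = contradiction n+q<n (m+n≮m n q)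
  ... | no _      | yes _     = cong (λ r → n′ ∸ r , k′ , 2 + r) (m+n∸m≡n n q)
  ... | no _      | no n+q≮2n = contradiction (y-bound q<n) n+q≮2n

  decode : ℕ → ℕ → ℕ
  decode a m with m ≟ k | m ≟ k′
  ... | yes _ | _     = n ∸ a
  ... | no _  | yes _ = n + (n′ ∸ a)
  ... | no _  | no _  = 2 * n + m

  decode-k : ∀ a → decode a k ≡ n ∸ a
  decode-k a with k ≟ k
  ... | yes _  = refl
  ... | no k≢k = contradiction refl k≢k

  decode-k′ : ∀ a → decode a k′ ≡ n + (n′ ∸ a)
  decode-k′ a with k′ ≟ k | k′ ≟ k′
  ... | yes k′≡k | _        = contradiction k′≡k (<⇒≢ (n<1+n k′))
  ... | no _     | yes _    = refl
  ... | no _     | no k′≢k′ = contradiction refl k′≢k′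

  decode-< : ∀ a {m} → m < k′ → decode a m ≡ 2 * n + m
  decode-< a {m} m<k′ with m ≟ k | m ≟ k′
  ... | yes refl | _        = contradiction m<k′ (<-asym (n<1+n k′))
  ... | no _     | yes refl = contradiction m<k′ (n≮n k′)
  ... | no _     | no _     = refl

  ∸2n<k′ : ∀ {j} → 2 * n ≤ j → j < k → j ∸ 2 * n < k′
  ∸2n<k′ {j} 2n≤j (s≤s j≤k′) = begin-strict
    j ∸ 2 * n            <⟨ m<m+n (j ∸ 2 * n) z<s ⟩
    j ∸ 2 * n + 2 * n    ≡⟨ m∸n+n≡m 2n≤j ⟩
    j                    ≤⟨ j≤k′ ⟩
    k′                   ∎
    where open ≤-Reasoning

  decode-shape : ∀ {j} → j < k → decode (proj₁ (shape j)) (proj₁ (proj₂ (shape j))) ≡ j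
  decode-shape {j} j<k with j <? n | j <? 2 * n
  ... | yes j<n | _        = trans (decode-k _) (m∸[m∸n]≡n (<⇒≤ j<n))
  ... | no j≮n  | yes j<2n =
    trans (decode-k′ _) (trans (cong (_+_ n) (m∸[m∸n]≡n (≤-pred (∸n<n n≤j j<2n)))) (m+[n∸m]≡n n≤j))
    where n≤j = ≮⇒≥ j≮n
  ... | no _    | no j≮2n  = trans (decode-< 0 (∸2n<k′ (≮⇒≥ j≮2n) j<k)) (m+[n∸m]≡n (≮⇒≥ j≮2n))

  length-shape : ∀ {j} → j < k → length (code (shape j)) ≡ n + suc k
  length-shape {j} j<k with j <? n | j <? 2 * n
  ... | yes j<n | _        = trans (length-code _ k j) (cong (_+ suc k) (m∸n+n≡m (<⇒≤ j<n)))
  ... | no j≮n  | yes j<2n =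
    trans (length-code (n′ ∸ q) k′ (2 + q))
          (trans (rearrange (n′ ∸ q) q k′) (cong (λ r → suc r + suc k) (m∸n+n≡m q≤n′)))
    where
    q = j ∸ n
    q≤n′ = ≤-pred (∸n<n (≮⇒≥ j≮n) j<2n)
    rearrange : ∀ r q k′ → r + (2 + q) + suc k′ ≡ suc (r + q) + suc (suc k′)
    rearrange = solve-∀
  ... | no _    | no j≮2n  =
    trans (length-code 0 t (n + k ∸ t))
          (trans (+-suc (n + k ∸ t) t) (trans (cong suc (m∸n+n≡m t≤n+k)) (sym (+-suc n k))))
    where
    t = j ∸ 2 * n
    t≤n+k = ≤-trans (<⇒≤ (∸2n<k′ (≮⇒≥ j≮2n) j<k)) (≤-trans (n≤1+n k′) (m≤n+m k n))

  h : Fin k → List Γ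
  h c = code (shape (toℕ c))

  h-injective : InjMorph h
  h-injective = uniform-injective h (λ c → length-shape (toℕ<n c)) letters-injective
    where
    letters-injective : ∀ {c c′} → h c ≡ h c′ → c ≡ c′
    letters-injective {c} {c′} eq =
      let a≡a′ , m≡m′ = code-injective (shape (toℕ c)) (shape (toℕ c′)) eq
      in toℕ-injective (trans (sym (decode-shape (toℕ<n c)))
                              (trans (cong₂ decode a≡a′ m≡m′) (decode-shape (toℕ<n c′))))

  h-x : ∀ {q} → q < n → h (x q) ≡ code (n ∸ q , k , q)
  h-x q<n = trans (cong (code ∘ shape) (toℕ-letter (x<k q<n))) (cong code (shape-x q<n))

  h-y : ∀ {q} → q < n → h (y q) ≡ code (n′ ∸ q , k′ , 2 + q)
  h-y q<n = trans (cong (code ∘ shape) (toℕ-letter (y<k q<n))) (cong code (shape-y q<n))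

  u b b′ v : List Γ
  u  = code (n , k , 0)
  b  = code (n′ , k′ , 2)
  b′ = code (n′ , k′ , 1)
  v  = concat (u ∷ u ∷ b ∷ u ∷ b ∷ b′ ∷ [])

  Z-++-h-x : ∀ {q} → q < n → Z q ++ h (x q) ≡ u ++ Z q
  Z-++-h-x {q} q<n = begin
    Z q ++ h (x q)                          ≡⟨ cong (Z q ++_) (h-x q<n) ⟩
    Z q ++ code (n ∸ q , k , q)             ≡⟨ Z-++-code q (n ∸ q) k 0 q ⟩
    code (q + (n ∸ q) , k , 0) ++ Z q       ≡⟨ cong (λ a → code (a , k , 0) ++ Z q) (m+[n∸m]≡n q≤n) ⟩
    u ++ Z q                                ∎
    where
    open ≡-Reasoning
    q≤n = <⇒≤ q<n

  Z-++-h-y : ∀ {q} c d → q < n → c + d ≡ 2 + q → Z q ++ h (y q) ≡ code (n′ , k′ , c) ++ Z d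
  Z-++-h-y {q} c d q<n c+d≡2+q = begin
    Z q ++ h (y q)                          ≡⟨ cong (Z q ++_) (h-y q<n) ⟩
    Z q ++ code (n′ ∸ q , k′ , 2 + q)       ≡⟨ cong (λ r → Z q ++ code (n′ ∸ q , k′ , r)) c+d≡2+q ⟨
    Z q ++ code (n′ ∸ q , k′ , c + d)       ≡⟨ Z-++-code q (n′ ∸ q) k′ c d ⟩
    code (q + (n′ ∸ q) , k′ , c) ++ Z d     ≡⟨ cong (λ a → code (a , k′ , c) ++ Z d) (m+[n∸m]≡n q≤n′) ⟩
    code (n′ , k′ , c) ++ Z d               ∎
    where
    open ≡-Reasoning
    q≤n′ = ≤-pred q<n

  Z-++-block : ∀ {q} → q < n → Z q ++ ext h (block q) ≡ v ++ Z (suc q)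
  Z-++-block {q} q<n = x-step (x-step (y-step (x-step (y-step (y-step′ (++-identityʳ (Z (suc q))))))))
    where
    x-step : ∀ {s t z} → Z q ++ s ≡ t ++ z → Z q ++ h (x q) ++ s ≡ (u ++ t) ++ z
    x-step = shift-++ (Z q) (h (x q)) u (Z q) (Z-++-h-x q<n)
    y-step : ∀ {s t z} → Z q ++ s ≡ t ++ z → Z q ++ h (y q) ++ s ≡ (b ++ t) ++ z
    y-step = shift-++ (Z q) (h (y q)) b (Z q) (Z-++-h-y 2 q q<n refl)
    y-step′ : ∀ {s t z} → Z (suc q) ++ s ≡ t ++ z → Z q ++ h (y q) ++ s ≡ (b′ ++ t) ++ z
    y-step′ = shift-++ (Z q) (h (y q)) b′ (Z (suc q)) (Z-++-h-y 1 (suc q) q<n refl)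

  Z-++-blocksFrom : ∀ a c → a + c ≤ n →
                    Z a ++ ext h (blocksFrom a c) ≡ concat (replicate c v) ++ Z (a + c)
  Z-++-blocksFrom a zero    _      = trans (++-identityʳ (Z a)) (cong Z (sym (+-identityʳ a)))
  Z-++-blocksFrom a (suc c) a+c≤n = begin
    Z a ++ ext h (block a ++ rest)                 ≡⟨ cong (Z a ++_) (concatMap-++ h (block a) rest) ⟩
    Z a ++ ext h (block a) ++ ext h rest           ≡⟨ ++-assoc (Z a) _ _ ⟨
    (Z a ++ ext h (block a)) ++ ext h rest         ≡⟨ cong (_++ ext h rest) (Z-++-block a<n) ⟩
    (v ++ Z (suc a)) ++ ext h rest                 ≡⟨ ++-assoc v _ _ ⟩
    v ++ Z (suc a) ++ ext h rest                   ≡⟨ cong (v ++_) (Z-++-blocksFrom (suc a) c 1+a+c≤n) ⟩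
    v ++ concat (replicate c v) ++ Z (suc a + c)   ≡⟨ ++-assoc v _ _ ⟨
    concat (replicate (suc c) v) ++ Z (suc a + c)  ≡⟨ cong (λ r → v^1+c ++ Z r) (+-suc a c) ⟨
    concat (replicate (suc c) v) ++ Z (a + suc c)  ∎
    where
    open ≡-Reasoning
    rest = blocksFrom (suc a) c
    v^1+c = concat (replicate (suc c) v)
    a<n = <-≤-trans (m<m+n a z<s) a+c≤n
    1+a+c≤n = subst (_≤ n) (+-suc a c) a+c≤n

  image-power : ext h w ≡ powPrefix v (n * length v + length (Z n))
  image-power = trans (Z-++-blocksFrom 0 n ≤-refl) (sym (powPrefix-*-+ g₀ (drop 1 v) n (Z n) _ v≡Zn++))
    where v≡Zn++ = ++-assoc (Z n) (O (suc k) ++ Z 0) (concat (u ∷ b ∷ u ∷ b ∷ b′ ∷ []))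

  EI>w : EI> {G = Γ} w ((+ n) / 1 - (+ 1) / 6)
  EI>w = h , h-injective , (+ p) / length v , (g₀ , drop 1 v , p , image-power , refl) ,
         ℚ.<-≤-trans (q-1/6<q _) (*≤*⇒/≤/ n 0 p (length (drop 1 v)) n*|v|≤p)
    where
    p = n * length v + length (Z n)
    n*|v|≤p = ≤-trans (m≤m+n (n * length v) _) (≤-reflexive (sym (*-identityʳ p)))

mainTheorem4 : (n : ℕ) → 1 ≤ n → (k : ℕ) → 2 * n ≤ k → (m : ℕ) → 2 ≤ m →
    Σ (List (Fin k)) λ w →
      (Σ (List (Fin k)) λ L → length L ≡ 2 * n × Unique L × (∀ a → (a ∈ w) ⇔ (a ∈ L)))
      × length w ≡ 6 * n
      × E≡ w ((+ 1) / 1)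
      × EI> {G = Fin m} w (((+ n) / 1) - ((+ 1) / 6))
      × EIfinite {G = Fin m} w
mainTheorem4 (suc n′) (s≤s z≤n) (suc k′) 2n≤k (suc (suc m′)) (s≤s (s≤s z≤n)) =
  w ,
  (alphabet , length-applyUpTo letter (2 * n) , alphabet-unique , λ _ → mk⇔ ∈-alphabet⁺ ∈-alphabet⁻) ,
  length-blocksFrom 0 n ,
  E≡w ,
  EI>w ,
  ((+ length w) / 1 , λ h h-injective → E≤-length h h-injective returns)
  where
  open Word n′ k′ 2n≤k
  open Morphism n′ k′ m′ 2n≤k using (EI>w)
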